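{- Let $G$ be a finite simple graph and let $S,T\in\Psi(G)$. Then $|S\cup (T\setminus N[S])|=|T\cup(S\setminus N[T])|$.
   Context: For a graph $G$ and $X\subseteq V(G)$, $N(X)$ is the set of vertices adjacent to some vertex of $X$ and $N[X]=X\cup N(X)$; $G[X]$ is the induced subgraph on $X$. A set $S\subseteq V(G)$ is a local maximum independent set of $G$ if $S$ is a maximum independent set of $G[N[S]]$; $\Psi(G)$ denotes the family of all local maximum independent sets of $G$. -}

module Defs where

open import Data.Nat using (ℕ; _≤_)
open import Data.Bool using (Bool; true; false; _∧_)
open import Data.Fin using (Fin)
open import Data.Fin.Subset using (Subset; _∈_; _⊆_; _∪_; ∣_∣)
open import Data.Vec using (tabulate; lookup)
open import Data.Bool.ListAction using (any)
open import Data.List.Base using (allFin)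
open import Data.Product using (_×_)
open import Relation.Binary.PropositionalEquality using (_≡_)

record SimpleGraph (n : ℕ) : Set where
  field
    Adj   : Fin n → Fin n → Bool
    sym   : ∀ u v → Adj u v ≡ Adj v u
    loopless : ∀ v → Adj v v ≡ false

open SimpleGraph public

module _ {n : ℕ} (G : SimpleGraph n) where

  N : Subset n → Subset n
  N X = tabulate λ v → any (λ u → lookup X u ∧ Adj G u v) (allFin n)

  N[_] : Subset n → Subset n
  N[ X ] = X ∪ N X

  Independent : Subset n → Set
  Independent S = ∀ u v → u ∈ S → v ∈ S → Adj G u v ≡ false

  -- S is a maximum independent set of the induced subgraph G[A]
  -- (for subsets of A, independence in G[A] coincides with independence in G)
  MaximumIndependentIn : Subset n → Subset n → Set
  MaximumIndependentIn A S =
    S ⊆ A × Independent S × (∀ I → I ⊆ A → Independent I → ∣ I ∣ ≤ ∣ S ∣)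

  -- S ∈ Ψ(G): S is a maximum independent set of G[N[S]]
  LocalMaxIndependent : Subset n → Set
  LocalMaxIndependent S = MaximumIndependentIn N[ S ] S

N[_,_] : ∀ {n} → SimpleGraph n → Subset n → Subset n
N[ G , X ] = N[_] G X

{-# OPTIONS --safe #-}
module Submission where

-- Since S ⊆ N[S], the set S ∪ (T ∖ N[S]) has |S| + |T| − |T ∩ N[S]|
-- elements, so it suffices to show |T ∩ N[S]| = |S ∩ N[T]|. The exchange set
-- (S ∖ N[T]) ∪ (T ∩ N[S]) is independent (a vertex outside N[T] has no neighbour
-- in T) and lies in N[S], so it has at most |S| elements since S ∈ Ψ(G); its size
-- is |S| − |S ∩ N[T]| + |T ∩ N[S]|, whence |T ∩ N[S]| ≤ |S ∩ N[T]|. Exchanging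
-- the roles of S and T gives equality.

open import Defs renaming (sym to Adj-sym)
open import Data.Nat using (ℕ; suc; _+_; _≤_)
open import Data.Nat.Properties
  using (+-suc; +-comm; +-cancelʳ-≡; +-cancelˡ-≤; +-monoˡ-≤; ≤-antisym; ≤-reflexive; ≤-trans;
         +-commutativeSemigroup)
open import Algebra.Properties.CommutativeSemigroup +-commutativeSemigroup
  using (xy∙z≈zx∙y; xy∙z≈x∙zy)
open import Data.Bool using (true; false; _∧_)
open import Data.Bool.Properties using (T-≡; ¬-not)
open import Data.Fin.Subset using (Subset; _∈_; _∉_; _⊆_; _∪_; _∩_; _─_; ∣_∣; inside; outside)
open import Data.Fin.Subset.Properties
  using (p⊆p∪q; q⊆p∪q; x∈p∪q⁻; p∩q⊆p; p∩q⊆q; p─q⊆p)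
open import Data.Vec using ([]; _∷_; here; there; lookup)
open import Data.Vec.Properties using (lookup⇒[]=; []=⇒lookup; lookup∘tabulate)
open import Data.List using (allFin)
open import Data.Bool.ListAction using (any)
import Data.List.Relation.Unary.Any as Any
open import Data.List.Relation.Unary.Any.Properties using (any⁺)
open import Data.List.Membership.Propositional.Properties using (∈-allFin)
open import Data.Product using (proj₁; proj₂)
open import Data.Sum using (inj₁; inj₂)
open import Function using (Equivalence)
open import Relation.Nullary using (contradiction)
open import Relation.Binary.PropositionalEquality using (_≡_; refl; sym; trans; cong; cong₂; module ≡-Reasoning)
open ≡-Reasoning

private variable n : ℕ

Disjoint : Subset n → Subset n → Set
Disjoint p q = ∀ {x} → x ∈ p → x ∉ q

x∈p─q⇒x∉q : ∀ (p q : Subset n) {x} → x ∈ p ─ q → x ∉ q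
x∈p─q⇒x∉q (_ ∷ p) (outside ∷ q) (there x∈p─q) (there x∈q) = x∈p─q⇒x∉q p q x∈p─q x∈q
x∈p─q⇒x∉q (_ ∷ p) (inside  ∷ q) (there x∈p─q) (there x∈q) = x∈p─q⇒x∉q p q x∈p─q x∈q

∣p∪q∣≡∣p∣+∣q∣ : ∀ (p q : Subset n) → Disjoint p q → ∣ p ∪ q ∣ ≡ ∣ p ∣ + ∣ q ∣
∣p∪q∣≡∣p∣+∣q∣ []            []            _   = refl
∣p∪q∣≡∣p∣+∣q∣ (inside  ∷ p) (inside  ∷ q) p#q = contradiction here (p#q here)
∣p∪q∣≡∣p∣+∣q∣ (inside  ∷ p) (outside ∷ q) p#q =
  cong suc (∣p∪q∣≡∣p∣+∣q∣ p q λ x∈p x∈q → p#q (there x∈p) (there x∈q))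
∣p∪q∣≡∣p∣+∣q∣ (outside ∷ p) (inside  ∷ q) p#q =
  trans (cong suc (∣p∪q∣≡∣p∣+∣q∣ p q λ x∈p x∈q → p#q (there x∈p) (there x∈q)))
        (sym (+-suc ∣ p ∣ ∣ q ∣))
∣p∪q∣≡∣p∣+∣q∣ (outside ∷ p) (outside ∷ q) p#q =
  ∣p∪q∣≡∣p∣+∣q∣ p q λ x∈p x∈q → p#q (there x∈p) (there x∈q)

∣p∩q∣+∣p─q∣≡∣p∣ : ∀ (p q : Subset n) → ∣ p ∩ q ∣ + ∣ p ─ q ∣ ≡ ∣ p ∣
∣p∩q∣+∣p─q∣≡∣p∣ []            []            = refl
∣p∩q∣+∣p─q∣≡∣p∣ (inside  ∷ p) (inside  ∷ q) = cong suc (∣p∩q∣+∣p─q∣≡∣p∣ p q)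
∣p∩q∣+∣p─q∣≡∣p∣ (inside  ∷ p) (outside ∷ q) =
  trans (+-suc ∣ p ∩ q ∣ ∣ p ─ q ∣) (cong suc (∣p∩q∣+∣p─q∣≡∣p∣ p q))
∣p∩q∣+∣p─q∣≡∣p∣ (outside ∷ p) (inside  ∷ q) = ∣p∩q∣+∣p─q∣≡∣p∣ p q
∣p∩q∣+∣p─q∣≡∣p∣ (outside ∷ p) (outside ∷ q) = ∣p∩q∣+∣p─q∣≡∣p∣ p q

∣p∪[q─r]∣+∣q∩r∣≡∣p∣+∣q∣ : ∀ (p q r : Subset n) → p ⊆ r →
                           ∣ p ∪ (q ─ r) ∣ + ∣ q ∩ r ∣ ≡ ∣ p ∣ + ∣ q ∣
∣p∪[q─r]∣+∣q∩r∣≡∣p∣+∣q∣ p q r p⊆r = begin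
  ∣ p ∪ (q ─ r) ∣ + ∣ q ∩ r ∣          ≡⟨ cong (_+ ∣ q ∩ r ∣) (∣p∪q∣≡∣p∣+∣q∣ p (q ─ r) p#q─r) ⟩
  (∣ p ∣ + ∣ q ─ r ∣) + ∣ q ∩ r ∣      ≡⟨ xy∙z≈x∙zy (∣ p ∣) (∣ q ─ r ∣) (∣ q ∩ r ∣) ⟩
  ∣ p ∣ + (∣ q ∩ r ∣ + ∣ q ─ r ∣)      ≡⟨ cong (∣ p ∣ +_) (∣p∩q∣+∣p─q∣≡∣p∣ q r) ⟩
  ∣ p ∣ + ∣ q ∣                        ∎
  where
  p#q─r : Disjoint p (q ─ r)
  p#q─r x∈p x∈q─r = x∈p─q⇒x∉q q r x∈q─r (p⊆r x∈p)

module _ (G : SimpleGraph n) where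

  adjacent⇒∈N : ∀ {X u v} → v ∈ X → Adj G v u ≡ true → u ∈ N G X
  adjacent⇒∈N {X} {u} {v} v∈X v~u = lookup⇒[]= u (N G X) (begin
    lookup (N G X) u                              ≡⟨ lookup∘tabulate _ u ⟩
    any (λ w → lookup X w ∧ Adj G w u) (allFin n) ≡⟨ Equivalence.to T-≡ (any⁺ _ v∈allFin) ⟩
    true                                          ∎)
    where
    v∈allFin = Any.map (λ { refl → Equivalence.from T-≡ (cong₂ _∧_ ([]=⇒lookup v∈X) v~u) })
                       (∈-allFin v)

  ∉N[]⇒nonadjacent : ∀ {X u v} → u ∉ N[ G , X ] → v ∈ X → Adj G u v ≡ false
  ∉N[]⇒nonadjacent {X} {u} {v} u∉N[X] v∈X = ¬-not λ u~v →
    u∉N[X] (q⊆p∪q X (N G X) (adjacent⇒∈N v∈X (trans (Adj-sym G v u) u~v)))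

  Independent-⊆ : ∀ {I J} → I ⊆ J → Independent G J → Independent G I
  Independent-⊆ I⊆J indJ u v u∈I v∈I = indJ u v (I⊆J u∈I) (I⊆J v∈I)

  Independent-∪ : ∀ {I J} → Independent G I → Independent G J →
                  (∀ u v → u ∈ I → v ∈ J → Adj G u v ≡ false) → Independent G (I ∪ J)
  Independent-∪ {I} {J} indI indJ I≁J u v u∈I∪J v∈I∪J
    with x∈p∪q⁻ I J u∈I∪J | x∈p∪q⁻ I J v∈I∪J
  ... | inj₁ u∈I | inj₁ v∈I = indI u v u∈I v∈I
  ... | inj₂ u∈J | inj₂ v∈J = indJ u v u∈J v∈J
  ... | inj₁ u∈I | inj₂ v∈J = I≁J u v u∈I v∈J
  ... | inj₂ u∈J | inj₁ v∈I = trans (Adj-sym G u v) (I≁J v u v∈I u∈J)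

  exchange : Subset n → Subset n → Subset n
  exchange S T = (S ─ N[ G , T ]) ∪ (T ∩ N[ G , S ])

  exchange-⊆N[] : ∀ S T → exchange S T ⊆ N[ G , S ]
  exchange-⊆N[] S T x∈E with x∈p∪q⁻ (S ─ N[ G , T ]) (T ∩ N[ G , S ]) x∈E
  ... | inj₁ x∈S─N[T] = p⊆p∪q (N G S) (p─q⊆p S N[ G , T ] x∈S─N[T])
  ... | inj₂ x∈T∩N[S] = p∩q⊆q T N[ G , S ] x∈T∩N[S]

  exchange-independent : ∀ {S T} → Independent G S → Independent G T →
                         Independent G (exchange S T)
  exchange-independent {S} {T} indS indT =
    Independent-∪ (Independent-⊆ (p─q⊆p S N[ G , T ]) indS)
                  (Independent-⊆ (p∩q⊆p T N[ G , S ]) indT)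
                  λ u v u∈S─N[T] v∈T∩N[S] →
                    ∉N[]⇒nonadjacent (x∈p─q⇒x∉q S N[ G , T ] u∈S─N[T])
                                     (p∩q⊆p T N[ G , S ] v∈T∩N[S])

  ∣exchange∣ : ∀ S T → ∣ exchange S T ∣ + ∣ S ∩ N[ G , T ] ∣ ≡ ∣ S ∣ + ∣ T ∩ N[ G , S ] ∣
  ∣exchange∣ S T = begin
    ∣ exchange S T ∣ + ∣ S ∩ N[T] ∣              ≡⟨ cong (_+ ∣ S ∩ N[T] ∣) (∣p∪q∣≡∣p∣+∣q∣ _ _ disjoint) ⟩
    (∣ S ─ N[T] ∣ + ∣ T ∩ N[S] ∣) + ∣ S ∩ N[T] ∣ ≡⟨ xy∙z≈zx∙y (∣ S ─ N[T] ∣) (∣ T ∩ N[S] ∣) (∣ S ∩ N[T] ∣) ⟩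
    (∣ S ∩ N[T] ∣ + ∣ S ─ N[T] ∣) + ∣ T ∩ N[S] ∣ ≡⟨ cong (_+ ∣ T ∩ N[S] ∣) (∣p∩q∣+∣p─q∣≡∣p∣ S N[T]) ⟩
    ∣ S ∣ + ∣ T ∩ N[S] ∣                         ∎
    where
    N[S] = N[ G , S ]
    N[T] = N[ G , T ]
    disjoint : Disjoint (S ─ N[T]) (T ∩ N[S])
    disjoint x∈S─N[T] x∈T∩N[S] =
      x∈p─q⇒x∉q S N[T] x∈S─N[T] (p⊆p∪q (N G T) (p∩q⊆p T N[S] x∈T∩N[S]))

  ∣T∩N[S]∣≤∣S∩N[T]∣ : ∀ {S T} → LocalMaxIndependent G S → Independent G T →
                      ∣ T ∩ N[ G , S ] ∣ ≤ ∣ S ∩ N[ G , T ] ∣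
  ∣T∩N[S]∣≤∣S∩N[T]∣ {S} {T} hS indT =
    +-cancelˡ-≤ ∣ S ∣ _ _ (≤-trans (≤-reflexive (sym (∣exchange∣ S T)))
      (+-monoˡ-≤ ∣ S ∩ N[ G , T ] ∣
        (maxS (exchange S T) (exchange-⊆N[] S T) (exchange-independent indS indT))))
    where
    indS = proj₁ (proj₂ hS)
    maxS = proj₂ (proj₂ hS)

  ∣T∩N[S]∣≡∣S∩N[T]∣ : ∀ {S T} → LocalMaxIndependent G S → LocalMaxIndependent G T →
                      ∣ T ∩ N[ G , S ] ∣ ≡ ∣ S ∩ N[ G , T ] ∣
  ∣T∩N[S]∣≡∣S∩N[T]∣ hS hT = ≤-antisym (∣T∩N[S]∣≤∣S∩N[T]∣ hS (proj₁ (proj₂ hT)))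
                                      (∣T∩N[S]∣≤∣S∩N[T]∣ hT (proj₁ (proj₂ hS)))

lemma3p5 : ∀ {n : ℕ} (G : SimpleGraph n) (S T : Subset n) →
    LocalMaxIndependent G S → LocalMaxIndependent G T →
    ∣ S ∪ (T ─ N[ G , S ]) ∣ ≡ ∣ T ∪ (S ─ N[ G , T ]) ∣
lemma3p5 G S T hS hT = +-cancelʳ-≡ ∣ T ∩ N[ G , S ] ∣ _ _ (begin
  ∣ S ∪ (T ─ N[ G , S ]) ∣ + ∣ T ∩ N[ G , S ] ∣ ≡⟨ ∣p∪[q─r]∣+∣q∩r∣≡∣p∣+∣q∣ S T _ (p⊆p∪q (N G S)) ⟩
  ∣ S ∣ + ∣ T ∣                                  ≡⟨ +-comm ∣ S ∣ ∣ T ∣ ⟩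
  ∣ T ∣ + ∣ S ∣                                  ≡⟨ ∣p∪[q─r]∣+∣q∩r∣≡∣p∣+∣q∣ T S _ (p⊆p∪q (N G T)) ⟨
  ∣ T ∪ (S ─ N[ G , T ]) ∣ + ∣ S ∩ N[ G , T ] ∣ ≡⟨ cong (∣ T ∪ (S ─ N[ G , T ]) ∣ +_) (∣T∩N[S]∣≡∣S∩N[T]∣ G hS hT) ⟨
  ∣ T ∪ (S ─ N[ G , T ]) ∣ + ∣ T ∩ N[ G , S ] ∣ ∎)
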